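{- Let $\vdash$ be $\vdash_p$ or $\vdash_p^Q$ plus additional axioms, fix a propositional formula $A$, let $j\varphi\equiv A\to\varphi$, and let $\vdash^j$ be $\vdash$ plus the axioms $A\to\varphi\vdash^j\varphi$ for all formulas $\varphi$. Then for every finite set of formulas $\Gamma$ and every formula $\varphi$, \[\Gamma\vdash^j\varphi\iff\Gamma\vdash A\to\varphi.\]
   Context: $S$ is a set of propositional (resp. first-order predicate) formulas containing $\top,\bot$ and closed under $\vee,\wedge,\to,\neg$ (and $\forall,\exists$). An entailment relation on $S$ is a relation ${\rhd}\subseteq\mathrm{Fin}(S)\times S$ (finite sets of formulas on the left) satisfying: (R) if $\varphi\in\Gamma$ then $\Gamma\rhd\varphi$; (T) if $\Gamma\rhd\psi$ and $\Gamma',\psi\rhd\varphi$ then $\Gamma,\Gamma'\rhd\varphi$; (M) if $\Gamma\rhd\varphi$ then $\Gamma,\Gamma'\rhd\varphi$. Positive logic $\vdash_p$ is the least entailment relation $\rhd$ satisfying rule R$\to$ (if $\Gamma,\varphi\rhd\psi$ then $\Gamma\rhd\varphi\to\psi$) and the axioms $\varphi,\psi\rhd\varphi\wedge\psi$; $\varphi\wedge\psi\rhd\varphi$; $\varphi\wedge\psi\rhd\psi$; $\varphi\rhd\varphi\vee\psi$; $\psi\rhd\varphi\vee\psi$; $\varphi\vee\psi,\varphi\to\delta,\psi\to\delta\rhd\delta$; $\varphi,\varphi\to\psi\rhd\psi$; $\emptyset\rhd\top$. $\vdash_p^Q$ is obtained by adding to this inductive definition the rules: L$\forall$: from $\varphi[t/x],\Gamma,\forall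 x\varphi\rhd\delta$ infer $\Gamma,\forall x\varphi\rhd\delta$; R$\forall$: from $\Gamma\rhd\varphi[y/x]$ infer $\Gamma\rhd\forall x\varphi$; L$\exists$: from $\Gamma,\varphi[y/x]\rhd\delta$ infer $\Gamma,\exists x\varphi\rhd\delta$; R$\exists$: from $\Gamma\rhd\varphi[t/x]$ infer $\Gamma\rhd\exists x\varphi$; with $y$ fresh in R$\forall$ and L$\exists$. "Plus additional axioms" means the least entailment relation satisfying the generating axioms and rules together with the new axioms. -}

module Defs where

open import Data.Nat using (ℕ; zero; suc)
open import Data.List using (List; []; _∷_; _++_; map)
open import Data.List.Membership.Propositional using (_∈_)
open import Data.List.Relation.Binary.Subset.Propositional using (_⊆_)
open import Data.Vec using (Vec; []; _∷_)
open import Data.Empty using (⊥)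
open import Data.Unit using (⊤)
open import Data.Product using (_×_)
open import Relation.Binary.PropositionalEquality using (_≡_)
open import Function.Bundles using (_⇔_)

-- Finite sets of formulas Fin(S) are represented by lists; since every
-- relation below is closed under rule M stated with list inclusion (⊆),
-- derivability only depends on the underlying set of a list.

module Prop (Atom : Set) where

  infixr 6 _∧'_
  infixr 5 _∨'_
  infixr 4 _⇒_

  data Form : Set where
    ⊤' ⊥' : Form
    atom  : Atom → Form
    _∧'_ _∨'_ _⇒_ : Form → Form → Form
    ¬'_   : Form → Form

  data Pos (Ax : List Form → Form → Set) : List Form → Form → Set where
    ax    : ∀ {Γ φ} → Ax Γ φ → Pos Ax Γ φ
    R     : ∀ {Γ φ} → φ ∈ Γ → Pos Ax Γ φ
    T     : ∀ {Γ Γ' ψ φ} → Pos Ax Γ ψ → Pos Ax (ψ ∷ Γ') φ → Pos Ax (Γ ++ Γ') φ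
    M     : ∀ {Γ Δ φ} → Pos Ax Γ φ → Γ ⊆ Δ → Pos Ax Δ φ
    R⇒    : ∀ {Γ φ ψ} → Pos Ax (φ ∷ Γ) ψ → Pos Ax Γ (φ ⇒ ψ)
    ∧I    : ∀ {φ ψ} → Pos Ax (φ ∷ ψ ∷ []) (φ ∧' ψ)
    ∧E₁   : ∀ {φ ψ} → Pos Ax ((φ ∧' ψ) ∷ []) φ
    ∧E₂   : ∀ {φ ψ} → Pos Ax ((φ ∧' ψ) ∷ []) ψ
    ∨I₁   : ∀ {φ ψ} → Pos Ax (φ ∷ []) (φ ∨' ψ)
    ∨I₂   : ∀ {φ ψ} → Pos Ax (ψ ∷ []) (φ ∨' ψ)
    ∨E    : ∀ {φ ψ δ} → Pos Ax ((φ ∨' ψ) ∷ (φ ⇒ δ) ∷ (ψ ⇒ δ) ∷ []) δ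
    MP    : ∀ {φ ψ} → Pos Ax (φ ∷ (φ ⇒ ψ) ∷ []) ψ
    ⊤I    : Pos Ax [] ⊤'

  data JAx (A : Form) (Ax : List Form → Form → Set) : List Form → Form → Set where
    old : ∀ {Γ φ} → Ax Γ φ → JAx A Ax Γ φ
    new : ∀ φ → JAx A Ax ((A ⇒ φ) ∷ []) φ

module FO (Fun : Set) (funAr : Fun → ℕ) (Pred : Set) (predAr : Pred → ℕ) where

  data Term : Set where
    var : ℕ → Term
    app : (f : Fun) → Vec Term (funAr f) → Term

  mutual
    substT : (ℕ → Term) → Term → Term
    substT σ (var x)    = σ x
    substT σ (app f ts) = app f (substTs σ ts)

    substTs : ∀ {n} → (ℕ → Term) → Vec Term n → Vec Term n
    substTs σ []       = []
    substTs σ (t ∷ ts) = substT σ t ∷ substTs σ ts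

  shiftT : Term → Term
  shiftT = substT (λ x → var (suc x))

  exts : (ℕ → Term) → ℕ → Term
  exts σ zero    = var zero
  exts σ (suc x) = shiftT (σ x)

  infixr 6 _∧'_
  infixr 5 _∨'_
  infixr 4 _⇒_

  data Form : Set where
    ⊤' ⊥' : Form
    atom  : (P : Pred) → Vec Term (predAr P) → Form
    _∧'_ _∨'_ _⇒_ : Form → Form → Form
    ¬'_   : Form → Form
    ∀' ∃' : Form → Form     -- binds de Bruijn index 0

  subst : (ℕ → Term) → Form → Form
  subst σ ⊤'         = ⊤'
  subst σ ⊥'         = ⊥'
  subst σ (atom P ts) = atom P (substTs σ ts)
  subst σ (φ ∧' ψ)   = subst σ φ ∧' subst σ ψ
  subst σ (φ ∨' ψ)   = subst σ φ ∨' subst σ ψ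
  subst σ (φ ⇒ ψ)    = subst σ φ ⇒ subst σ ψ
  subst σ (¬' φ)     = ¬' subst σ φ
  subst σ (∀' φ)     = ∀' (subst (exts σ) φ)
  subst σ (∃' φ)     = ∃' (subst (exts σ) φ)

  -- weakening: shift all free variables up by one (makes index 0 fresh)
  ↑ : Form → Form
  ↑ = subst (λ x → var (suc x))

  inst : Term → ℕ → Term
  inst t zero    = t
  inst t (suc x) = var x

  _[_] : Form → Term → Form
  φ [ t ] = subst (inst t) φ

  IsPropositional : Form → Set
  IsPropositional ⊤'          = ⊤
  IsPropositional ⊥'          = ⊤
  IsPropositional (atom P ts) = predAr P ≡ 0
  IsPropositional (φ ∧' ψ)    = IsPropositional φ × IsPropositional ψ
  IsPropositional (φ ∨' ψ)    = IsPropositional φ × IsPropositional ψ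
  IsPropositional (φ ⇒ ψ)     = IsPropositional φ × IsPropositional ψ
  IsPropositional (¬' φ)      = IsPropositional φ
  IsPropositional (∀' φ)      = ⊥
  IsPropositional (∃' φ)      = ⊥

  data PosQ (Ax : List Form → Form → Set) : List Form → Form → Set where
    ax    : ∀ {Γ φ} → Ax Γ φ → PosQ Ax Γ φ
    R     : ∀ {Γ φ} → φ ∈ Γ → PosQ Ax Γ φ
    T     : ∀ {Γ Γ' ψ φ} → PosQ Ax Γ ψ → PosQ Ax (ψ ∷ Γ') φ → PosQ Ax (Γ ++ Γ') φ
    M     : ∀ {Γ Δ φ} → PosQ Ax Γ φ → Γ ⊆ Δ → PosQ Ax Δ φ
    R⇒    : ∀ {Γ φ ψ} → PosQ Ax (φ ∷ Γ) ψ → PosQ Ax Γ (φ ⇒ ψ)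
    ∧I    : ∀ {φ ψ} → PosQ Ax (φ ∷ ψ ∷ []) (φ ∧' ψ)
    ∧E₁   : ∀ {φ ψ} → PosQ Ax ((φ ∧' ψ) ∷ []) φ
    ∧E₂   : ∀ {φ ψ} → PosQ Ax ((φ ∧' ψ) ∷ []) ψ
    ∨I₁   : ∀ {φ ψ} → PosQ Ax (φ ∷ []) (φ ∨' ψ)
    ∨I₂   : ∀ {φ ψ} → PosQ Ax (ψ ∷ []) (φ ∨' ψ)
    ∨E    : ∀ {φ ψ δ} → PosQ Ax ((φ ∨' ψ) ∷ (φ ⇒ δ) ∷ (ψ ⇒ δ) ∷ []) δ
    MP    : ∀ {φ ψ} → PosQ Ax (φ ∷ (φ ⇒ ψ) ∷ []) ψ
    ⊤I    : PosQ Ax [] ⊤'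
    L∀    : ∀ {Γ φ δ} t → PosQ Ax ((φ [ t ]) ∷ (∀' φ) ∷ Γ) δ → PosQ Ax ((∀' φ) ∷ Γ) δ
    -- from Γ ▷ φ[y/x] (y fresh) infer Γ ▷ ∀xφ
    R∀    : ∀ {Γ φ} → PosQ Ax (map ↑ Γ) φ → PosQ Ax Γ (∀' φ)
    -- from Γ, φ[y/x] ▷ δ (y fresh) infer Γ, ∃xφ ▷ δ
    L∃    : ∀ {Γ φ δ} → PosQ Ax (φ ∷ map ↑ Γ) (↑ δ) → PosQ Ax ((∃' φ) ∷ Γ) δ
    R∃    : ∀ {Γ φ} t → PosQ Ax Γ (φ [ t ]) → PosQ Ax Γ (∃' φ)

  data JAx (A : Form) (Ax : List Form → Form → Set) : List Form → Form → Set where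
    old : ∀ {Γ φ} → Ax Γ φ → JAx A Ax Γ φ
    new : ∀ φ → JAx A Ax ((A ⇒ φ) ∷ []) φ

PropCase : Set₁
PropCase = (Atom : Set) (Ax : List (Prop.Form Atom) → Prop.Form Atom → Set)
           (A : Prop.Form Atom) (Γ : List (Prop.Form Atom)) (φ : Prop.Form Atom) →
           Prop.Pos Atom (Prop.JAx Atom A Ax) Γ φ ⇔ Prop.Pos Atom Ax Γ (Prop._⇒_ A φ)

FOCase : Set₁
FOCase = (Fun : Set) (funAr : Fun → ℕ) (Pred : Set) (predAr : Pred → ℕ) →
         let open FO Fun funAr Pred predAr in
         (Ax : List Form → Form → Set) (A : Form) → IsPropositional A →
         (Γ : List Form) (φ : Form) →
         PosQ (JAx A Ax) Γ φ ⇔ PosQ Ax Γ (A ⇒ φ)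

-- Read j φ = A → φ as a modality: for fixed A the relation Γ ▷ A → φ is
-- again an entailment relation closed under the rules of positive logic
-- (for L∃ and R∀ this uses that A, being propositional, has no free
-- variables), and it validates the axioms A → φ ▷ φ trivially.  Being the
-- least such relation, ⊢^j is contained in it.  Conversely ⊢ ⊆ ⊢^j, and one
-- application of the new axiom turns Γ ⊢ A → φ into Γ ⊢^j φ.

module Submission where

open import Defs
open import Data.Product using (_×_; _,_)
open import Data.Sum using (reduce)
open import Data.Nat using (ℕ)
open import Data.Vec using (Vec; []; _∷_)
open import Data.List using (List; []; _∷_; _++_; map)
open import Data.List.Membership.Propositional using (_∈_)
open import Data.List.Membership.Propositional.Properties using (∈-++⁻)
open import Data.List.Relation.Unary.Any using (here)
open import Data.List.Relation.Binary.Subset.Propositional using (_⊆_)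
open import Data.List.Relation.Binary.Subset.Propositional.Properties
  using (⊆-reflexive-↭; ∷⁺ʳ; xs⊆xs++ys; xs⊆ys++xs)
open import Data.List.Relation.Binary.Permutation.Propositional using (↭-swap; ↭-refl)
open import Relation.Binary.PropositionalEquality using (_≡_; refl; sym; cong; cong₂) renaming (subst to ≡-subst)
open import Function.Bundles using (_⇔_; mk⇔)

module EntailmentWithImplication
  {F : Set} {_⇒_ : F → F → F} {_▷_ : List F → F → Set}
  (R   : ∀ {Γ φ} → φ ∈ Γ → Γ ▷ φ)
  (T   : ∀ {Γ Γ' ψ φ} → Γ ▷ ψ → (ψ ∷ Γ') ▷ φ → (Γ ++ Γ') ▷ φ)
  (M   : ∀ {Γ Δ φ} → Γ ▷ φ → Γ ⊆ Δ → Δ ▷ φ)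
  (R⇒  : ∀ {Γ φ ψ} → (φ ∷ Γ) ▷ ψ → Γ ▷ (φ ⇒ ψ))
  (MP  : ∀ {φ ψ} → (φ ∷ (φ ⇒ ψ) ∷ []) ▷ ψ)
  where

  weaken : ∀ {Γ φ ψ} → Γ ▷ φ → (ψ ∷ Γ) ▷ φ
  weaken d = M d (xs⊆ys++xs _ (_ ∷ []))

  exchange : ∀ {Γ φ ψ δ} → (φ ∷ ψ ∷ Γ) ▷ δ → (ψ ∷ φ ∷ Γ) ▷ δ
  exchange d = M d (⊆-reflexive-↭ (↭-swap _ _ ↭-refl))

  cut : ∀ {Γ ψ φ} → Γ ▷ ψ → (ψ ∷ Γ) ▷ φ → Γ ▷ φ
  cut {Γ} d e = M (T d e) (λ p → reduce (∈-++⁻ Γ p))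

  modus-ponens : ∀ {Γ φ ψ} → Γ ▷ φ → Γ ▷ (φ ⇒ ψ) → Γ ▷ ψ
  modus-ponens d e = cut d (cut (weaken e) (M (exchange MP) (xs⊆xs++ys _ _)))

  R⇒⁻¹ : ∀ {Γ φ ψ} → Γ ▷ (φ ⇒ ψ) → (φ ∷ Γ) ▷ ψ
  R⇒⁻¹ d = modus-ponens (R (here refl)) (weaken d)

  ⇒-const : ∀ {Γ A φ} → Γ ▷ φ → Γ ▷ (A ⇒ φ)
  ⇒-const d = R⇒ (weaken d)

  T-under : ∀ {Γ Γ' A ψ φ} → Γ ▷ (A ⇒ ψ) → (ψ ∷ Γ') ▷ (A ⇒ φ) → (Γ ++ Γ') ▷ (A ⇒ φ)
  T-under {Γ} {Γ'} {A} {ψ} d e =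
    R⇒ (cut (M (R⇒⁻¹ d) (∷⁺ʳ A (xs⊆xs++ys Γ Γ')))
            (M (exchange (R⇒⁻¹ e)) (∷⁺ʳ ψ (∷⁺ʳ A (xs⊆ys++xs Γ' Γ)))))

  R⇒-under : ∀ {Γ A φ ψ} → (φ ∷ Γ) ▷ (A ⇒ ψ) → Γ ▷ (A ⇒ (φ ⇒ ψ))
  R⇒-under d = R⇒ (R⇒ (exchange (R⇒⁻¹ d)))

module PropositionalCase (Atom : Set) where
  open Prop Atom

  module _ {Ax : List Form → Form → Set} where
    open EntailmentWithImplication {_▷_ = Pos Ax} R T M R⇒ MP public

  Pos-derive : ∀ {Ax Ax'} → (∀ {Γ φ} → Ax Γ φ → Pos Ax' Γ φ) →
               ∀ {Γ φ} → Pos Ax Γ φ → Pos Ax' Γ φ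
  Pos-derive f (ax x)  = f x
  Pos-derive f (R p)   = R p
  Pos-derive f (T d e) = T (Pos-derive f d) (Pos-derive f e)
  Pos-derive f (M d s) = M (Pos-derive f d) s
  Pos-derive f (R⇒ d)  = R⇒ (Pos-derive f d)
  Pos-derive f ∧I      = ∧I
  Pos-derive f ∧E₁     = ∧E₁
  Pos-derive f ∧E₂     = ∧E₂
  Pos-derive f ∨I₁     = ∨I₁
  Pos-derive f ∨I₂     = ∨I₂
  Pos-derive f ∨E      = ∨E
  Pos-derive f MP      = MP
  Pos-derive f ⊤I      = ⊤I

  relativise : ∀ {Ax Ax' A} → (∀ {Γ φ} → Ax' Γ φ → Pos Ax Γ (A ⇒ φ)) →
               ∀ {Γ φ} → Pos Ax' Γ φ → Pos Ax Γ (A ⇒ φ)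
  relativise f (ax x)  = f x
  relativise f (R p)   = ⇒-const (R p)
  relativise f (T d e) = T-under (relativise f d) (relativise f e)
  relativise f (M d s) = M (relativise f d) s
  relativise f (R⇒ d)  = R⇒-under (relativise f d)
  relativise f ∧I      = ⇒-const ∧I
  relativise f ∧E₁     = ⇒-const ∧E₁
  relativise f ∧E₂     = ⇒-const ∧E₂
  relativise f ∨I₁     = ⇒-const ∨I₁
  relativise f ∨I₂     = ⇒-const ∨I₂
  relativise f ∨E      = ⇒-const ∨E
  relativise f MP      = ⇒-const MP
  relativise f ⊤I      = ⇒-const ⊤I

  j-deduction : ∀ Ax A Γ φ → Pos (JAx A Ax) Γ φ ⇔ Pos Ax Γ (A ⇒ φ)
  j-deduction Ax A Γ φ = mk⇔ (relativise j-axiom) j-elim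
    where
    j-axiom : ∀ {Δ ψ} → JAx A Ax Δ ψ → Pos Ax Δ (A ⇒ ψ)
    j-axiom (old x) = ⇒-const (ax x)
    j-axiom (new ψ) = R (here refl)

    j-elim : Pos Ax Γ (A ⇒ φ) → Pos (JAx A Ax) Γ φ
    j-elim d = cut (Pos-derive (λ x → ax (old x)) d) (M (ax (new φ)) (xs⊆xs++ys _ Γ))

module FirstOrderCase (Fun : Set) (funAr : Fun → ℕ) (Pred : Set) (predAr : Pred → ℕ) where
  open FO Fun funAr Pred predAr

  substTs-nullary : ∀ {n} σ (ts : Vec Term n) → n ≡ 0 → substTs σ ts ≡ ts
  substTs-nullary σ []      _  = refl
  substTs-nullary σ (_ ∷ _) ()

  subst-propositional : ∀ σ A → IsPropositional A → subst σ A ≡ A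
  subst-propositional σ ⊤'          _       = refl
  subst-propositional σ ⊥'          _       = refl
  subst-propositional σ (atom P ts) n≡0     = cong (atom P) (substTs-nullary σ ts n≡0)
  subst-propositional σ (A ∧' B)    (a , b) = cong₂ _∧'_ (subst-propositional σ A a) (subst-propositional σ B b)
  subst-propositional σ (A ∨' B)    (a , b) = cong₂ _∨'_ (subst-propositional σ A a) (subst-propositional σ B b)
  subst-propositional σ (A ⇒ B)     (a , b) = cong₂ _⇒_ (subst-propositional σ A a) (subst-propositional σ B b)
  subst-propositional σ (¬' A)      a       = cong ¬'_ (subst-propositional σ A a)

  module _ {Ax : List Form → Form → Set} where
    open EntailmentWithImplication {_▷_ = PosQ Ax} R T M R⇒ MP public

  PosQ-derive : ∀ {Ax Ax'} → (∀ {Γ φ} → Ax Γ φ → PosQ Ax' Γ φ) →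
                ∀ {Γ φ} → PosQ Ax Γ φ → PosQ Ax' Γ φ
  PosQ-derive f (ax x)    = f x
  PosQ-derive f (R p)     = R p
  PosQ-derive f (T d e)   = T (PosQ-derive f d) (PosQ-derive f e)
  PosQ-derive f (M d s)   = M (PosQ-derive f d) s
  PosQ-derive f (R⇒ d)    = R⇒ (PosQ-derive f d)
  PosQ-derive f ∧I        = ∧I
  PosQ-derive f ∧E₁       = ∧E₁
  PosQ-derive f ∧E₂       = ∧E₂
  PosQ-derive f ∨I₁       = ∨I₁
  PosQ-derive f ∨I₂       = ∨I₂
  PosQ-derive f ∨E        = ∨E
  PosQ-derive f MP        = MP
  PosQ-derive f ⊤I        = ⊤I
  PosQ-derive f (L∀ t d)  = L∀ t (PosQ-derive f d)
  PosQ-derive f (R∀ d)    = R∀ (PosQ-derive f d)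
  PosQ-derive f (L∃ d)    = L∃ (PosQ-derive f d)
  PosQ-derive f (R∃ t d)  = R∃ t (PosQ-derive f d)

  module _ {Ax : List Form → Form → Set} {A : Form} (↑A≡A : ↑ A ≡ A) where

    R∀-under : ∀ {Γ φ} → PosQ Ax (map ↑ Γ) (A ⇒ φ) → PosQ Ax Γ (A ⇒ ∀' φ)
    R∀-under {Γ} {φ} d =
      R⇒ (R∀ (≡-subst (λ B → PosQ Ax (B ∷ map ↑ Γ) φ) (sym ↑A≡A) (R⇒⁻¹ d)))

    L∃-under : ∀ {Γ φ δ} → PosQ Ax (φ ∷ map ↑ Γ) (A ⇒ ↑ δ) → PosQ Ax (∃' φ ∷ Γ) (A ⇒ δ)
    L∃-under {Γ} {φ} {δ} d =
      R⇒ (exchange (L∃ (≡-subst (λ B → PosQ Ax (φ ∷ B ∷ map ↑ Γ) (↑ δ)) (sym ↑A≡A)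
                                (exchange (R⇒⁻¹ d)))))

    relativise : ∀ {Ax'} → (∀ {Γ φ} → Ax' Γ φ → PosQ Ax Γ (A ⇒ φ)) →
                 ∀ {Γ φ} → PosQ Ax' Γ φ → PosQ Ax Γ (A ⇒ φ)
    relativise f (ax x)    = f x
    relativise f (R p)     = ⇒-const (R p)
    relativise f (T d e)   = T-under (relativise f d) (relativise f e)
    relativise f (M d s)   = M (relativise f d) s
    relativise f (R⇒ d)    = R⇒-under (relativise f d)
    relativise f ∧I        = ⇒-const ∧I
    relativise f ∧E₁       = ⇒-const ∧E₁
    relativise f ∧E₂       = ⇒-const ∧E₂
    relativise f ∨I₁       = ⇒-const ∨I₁
    relativise f ∨I₂       = ⇒-const ∨I₂
    relativise f ∨E        = ⇒-const ∨E
    relativise f MP        = ⇒-const MP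
    relativise f ⊤I        = ⇒-const ⊤I
    relativise f (L∀ t d)  = L∀ t (relativise f d)
    relativise f (R∀ d)    = R∀-under (relativise f d)
    relativise f (L∃ d)    = L∃-under (relativise f d)
    relativise f (R∃ t d)  = R⇒ (R∃ t (R⇒⁻¹ (relativise f d)))

  j-deduction : ∀ Ax A → IsPropositional A → ∀ Γ φ → PosQ (JAx A Ax) Γ φ ⇔ PosQ Ax Γ (A ⇒ φ)
  j-deduction Ax A propA Γ φ = mk⇔ (relativise (subst-propositional _ A propA) j-axiom) j-elim
    where
    j-axiom : ∀ {Δ ψ} → JAx A Ax Δ ψ → PosQ Ax Δ (A ⇒ ψ)
    j-axiom (old x) = ⇒-const (ax x)
    j-axiom (new ψ) = R (here refl)

    j-elim : PosQ Ax Γ (A ⇒ φ) → PosQ (JAx A Ax) Γ φ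
    j-elim d = cut (PosQ-derive (λ x → ax (old x)) d) (M (ax (new φ)) (xs⊆xs++ys _ Γ))

mainTheorem8 : PropCase × FOCase
mainTheorem8 = PropositionalCase.j-deduction , FirstOrderCase.j-deduction
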